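{- (1) Given a CKBI algebra $\mathbb{A}$, the prime filter frame $Pr(\mathbb{A})=(Pr(\mathbb{A}),\circ_{\mathbb{A}},E_{\mathbb{A}},\triangleright_{\mathbb{A}})$ is a CKBI frame. (2) Given a CKBI frame $\mathcal{X}$, the complex algebra $Com(\mathcal{X})$ is a CKBI algebra.
   Context: A BBI algebra is $(A,\wedge,\vee,\to,\top,\bot,*,\mathbin{ -\!\!*},\top^*)$ with Boolean reduct, $(A,*,\top^*)$ a commutative monoid and $a*b\le c$ iff $a\le b\mathbin{ -\!\!*}c$. A CKBI algebra is a BBI algebra with further binary operations $;$, $\rightharpoonup$, $\leftharpoonup$ such that $(A,;,\top^*)$ is a monoid, $a;b\le c$ iff $a\le b\rightharpoonup c$ iff $b\le a\leftharpoonup c$, and (Exchange) $(a*b);(c*d)\le(a;c)*(b;d)$. A BBI frame $(X,\circ,E)$: $\circ:X^2\to\mathcal{P}(X)$, $E\subseteq X$, with $z\in x\circ y\to z\in y\circ x$; $\exists e\in E(x\in x\circ e)$; $x\in y\circ e\wedge e\in E\to y=x$; $t\in x\circ y\wedge w\in t\circ z\to\exists s(s\in y\circ z\wedge w\in x\circ s)$. A CKBI frame is $(X,\circ,E,\triangleright)$ with $(X,\circ,E)$ a BBI frame and $\triangleright:X^2\to\mathcal{P}(X)$ satisfying: $\exists e\in E(x\in e\triangleright x)$; $\exists e\in E(x\in x\triangleright e)$; $e\in E\wedge x\in e\triangleright y\to x=y$; $e\in E\wedge x\in y\triangleright e\to x=y$; (Associativity) $\exists t(t\in x\triangleright y\wedge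 w\in t\triangleright z)\leftrightarrow\exists t'(t'\in y\triangleright z\wedge w\in x\triangleright t')$; (Exchange) $t\in w\circ y\wedge s\in x\circ z\wedge u\in t\triangleright s\to\exists r,v(r\in w\triangleright x\wedge v\in y\triangleright z\wedge u\in r\circ v)$. Prime filter frame: prime filters of $\mathbb{A}$; $F\circ_{\mathbb{A}}F'=\{F''\mid\forall a\in F,b\in F':a*b\in F''\}$; $E_{\mathbb{A}}=\{F\mid\top^*\in F\}$; $F\triangleright_{\mathbb{A}}F'=\{F''\mid\forall a\in F,b\in F':a;b\in F''\}$. Complex algebra: $(\mathcal{P}(X),\cap,\cup,A\Rightarrow B=\overline{A}\cup B,X,\emptyset,\bullet,\mathbin{ -\!\!\bullet},E,;_{\mathcal{X}},\rightharpoonup_{\mathcal{X}},\leftharpoonup_{\mathcal{X}})$ with $A\bullet B=\{x\mid\exists y\in A,z\in B(x\in y\circ z)\}$, $A\mathbin{ -\!\!\bullet}B=\{x\mid\forall y,z(z\in x\circ y\wedge y\in A\Rightarrow z\in B)\}$, $A;_{\mathcal{X}}B=\{z\mid\exists x\in A,y\in B(z\in x\triangleright y)\}$, $A\rightharpoonup_{\mathcal{X}}B=\{x\mid\forall y,z(z\in x\triangleright y\wedge y\in A\Rightarrow z\in B)\}$, $A\leftharpoonup_{\mathcal{X}}B=\{x\mid\forall y,z(z\in y\triangleright x\wedge y\in A\Rightarrow z\in B)\}$. -}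

module Defs where

open import Level using (Level; _⊔_; suc)
open import Data.Product using (Σ; ∃; _×_; _,_)
open import Data.Sum using (_⊎_)
open import Data.Empty using (⊥)
import Data.Empty.Polymorphic as P⊥
open import Data.Unit.Polymorphic using (⊤)
open import Relation.Nullary using (¬_)
open import Relation.Unary using (Pred; _∈_; _∉_; _⊆_)
open import Relation.Binary.Core using (Rel)
open import Relation.Binary.PropositionalEquality using (_≡_)
open import Algebra.Core using (Op₂)
open import Algebra.Structures using (IsCommutativeMonoid; IsMonoid)
import Algebra.Lattice.Structures as LS

LatLeq : ∀ {c ℓ} {A : Set c} → Rel A ℓ → Op₂ A → A → A → Set ℓ
LatLeq _≈_ _∧_ a b = (a ∧ b) ≈ a

record IsBBIAlgebra {c ℓ} {A : Set c} (_≈_ : Rel A ℓ)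
    (_∧_ _∨_ _⇒_ : Op₂ A) (⊤ₐ ⊥ₐ : A) (_*_ _-*_ : Op₂ A) (⊤* : A) : Set (c ⊔ ℓ) where
  _≤_ : A → A → Set ℓ
  _≤_ = LatLeq _≈_ _∧_
  field
    isBooleanAlgebra      : LS.IsBooleanAlgebra _≈_ _∨_ _∧_ (λ a → a ⇒ ⊥ₐ) ⊤ₐ ⊥ₐ
    ⇒-def                 : ∀ a b → (a ⇒ b) ≈ ((a ⇒ ⊥ₐ) ∨ b)
    *-isCommutativeMonoid : IsCommutativeMonoid _≈_ _*_ ⊤*
    residuation₁          : ∀ a b d → (a * b) ≤ d → a ≤ (b -* d)
    residuation₂          : ∀ a b d → a ≤ (b -* d) → (a * b) ≤ d

record IsCKBIAlgebra {c ℓ} {A : Set c} (_≈_ : Rel A ℓ)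
    (_∧_ _∨_ _⇒_ : Op₂ A) (⊤ₐ ⊥ₐ : A) (_*_ _-*_ : Op₂ A) (⊤* : A)
    (_︔_ _⇀_ _↼_ : Op₂ A) : Set (c ⊔ ℓ) where
  _≤_ : A → A → Set ℓ
  _≤_ = LatLeq _≈_ _∧_
  field
    isBBIAlgebra  : IsBBIAlgebra _≈_ _∧_ _∨_ _⇒_ ⊤ₐ ⊥ₐ _*_ _-*_ ⊤*
    ︔-isMonoid    : IsMonoid _≈_ _︔_ ⊤*
    ⇀-residual₁   : ∀ a b d → (a ︔ b) ≤ d → a ≤ (b ⇀ d)
    ⇀-residual₂   : ∀ a b d → a ≤ (b ⇀ d) → (a ︔ b) ≤ d
    ↼-residual₁   : ∀ a b d → (a ︔ b) ≤ d → b ≤ (a ↼ d)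
    ↼-residual₂   : ∀ a b d → b ≤ (a ↼ d) → (a ︔ b) ≤ d
    exchange      : ∀ a b d e → ((a * b) ︔ (d * e)) ≤ ((a ︔ d) * (b ︔ e))

record CKBIAlgebra (c ℓ : Level) : Set (suc (c ⊔ ℓ)) where
  infix 4 _≈_
  field
    Carrier : Set c
    _≈_     : Rel Carrier ℓ
    _∧_ _∨_ _⇒_ : Op₂ Carrier
    ⊤ₐ ⊥ₐ   : Carrier
    _*_ _-*_ : Op₂ Carrier
    ⊤*      : Carrier
    _︔_ _⇀_ _↼_ : Op₂ Carrier
    isCKBIAlgebra : IsCKBIAlgebra _≈_ _∧_ _∨_ _⇒_ ⊤ₐ ⊥ₐ _*_ _-*_ ⊤* _︔_ _⇀_ _↼_

  _≤_ : Carrier → Carrier → Set ℓ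
  _≤_ = LatLeq _≈_ _∧_

-- Frames.  The point equality _≈_ is a parameter: it is _≡_ for frames
-- on a plain type, and extensional equality for the prime filter frame.

record IsBBIFrame {x e r r'} {X : Set x} (_≈_ : Rel X e)
    (_∘_ : X → X → Pred X r) (E : Pred X r') : Set (x ⊔ e ⊔ r ⊔ r') where
  field
    comm       : ∀ {x y z} → z ∈ (x ∘ y) → z ∈ (y ∘ x)
    unit-ex    : ∀ x → Σ X λ u → u ∈ E × x ∈ (x ∘ u)
    unit-eq    : ∀ {x y u} → x ∈ (y ∘ u) → u ∈ E → y ≈ x
    assoc      : ∀ {t x y w z} → t ∈ (x ∘ y) → w ∈ (t ∘ z) →
                 Σ X λ s → s ∈ (y ∘ z) × w ∈ (x ∘ s)

record IsCKBIFrame {x e r r'} {X : Set x} (_≈_ : Rel X e)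
    (_∘_ : X → X → Pred X r) (E : Pred X r') (_▷_ : X → X → Pred X r)
    : Set (x ⊔ e ⊔ r ⊔ r') where
  field
    isBBIFrame : IsBBIFrame _≈_ _∘_ E
    ▷-unitˡ-ex : ∀ x → Σ X λ u → u ∈ E × x ∈ (u ▷ x)
    ▷-unitʳ-ex : ∀ x → Σ X λ u → u ∈ E × x ∈ (x ▷ u)
    ▷-unitˡ-eq : ∀ {u x y} → u ∈ E → x ∈ (u ▷ y) → x ≈ y
    ▷-unitʳ-eq : ∀ {u x y} → u ∈ E → x ∈ (y ▷ u) → x ≈ y
    ▷-assoc₁   : ∀ {x y z w} → (Σ X λ t → t ∈ (x ▷ y) × w ∈ (t ▷ z)) →
                 (Σ X λ t' → t' ∈ (y ▷ z) × w ∈ (x ▷ t'))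
    ▷-assoc₂   : ∀ {x y z w} → (Σ X λ t' → t' ∈ (y ▷ z) × w ∈ (x ▷ t')) →
                 (Σ X λ t → t ∈ (x ▷ y) × w ∈ (t ▷ z))
    exchange   : ∀ {t w y s x z u} → t ∈ (w ∘ y) → s ∈ (x ∘ z) → u ∈ (t ▷ s) →
                 Σ X λ r → Σ X λ v → r ∈ (w ▷ x) × v ∈ (y ▷ z) × u ∈ (r ∘ v)

record CKBIFrame (ℓ : Level) : Set (suc ℓ) where
  field
    X   : Set ℓ
    _∘_ : X → X → Pred X ℓ
    E   : Pred X ℓ
    _▷_ : X → X → Pred X ℓ
    isCKBIFrame : IsCKBIFrame _≡_ _∘_ E _▷_

module PrimeFilters {c ℓ} (𝔸 : CKBIAlgebra c ℓ) where
  open CKBIAlgebra 𝔸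

  Sub : Set (suc (c ⊔ ℓ))
  Sub = Pred Carrier (c ⊔ ℓ)

  record IsFilter (F : Sub) : Set (c ⊔ ℓ) where
    field
      top∈    : ⊤ₐ ∈ F
      up      : ∀ {a b} → a ∈ F → a ≤ b → b ∈ F
      ∧-closed : ∀ {a b} → a ∈ F → b ∈ F → (a ∧ b) ∈ F

  record IsIdeal (I : Sub) : Set (c ⊔ ℓ) where
    field
      bot∈    : ⊥ₐ ∈ I
      down    : ∀ {a b} → b ∈ I → a ≤ b → a ∈ I
      ∨-closed : ∀ {a b} → a ∈ I → b ∈ I → (a ∨ b) ∈ I

  record IsPrimeFilter (F : Sub) : Set (c ⊔ ℓ) where
    field
      isFilter : IsFilter F
      proper   : ⊥ₐ ∉ F
      prime    : ∀ {a b} → (a ∨ b) ∈ F → a ∈ F ⊎ b ∈ F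

  PrimeFilter : Set (suc (c ⊔ ℓ))
  PrimeFilter = Σ Sub IsPrimeFilter

  carrierOf : PrimeFilter → Sub
  carrierOf (F , _) = F

  _≐_ : Rel PrimeFilter (c ⊔ ℓ)
  P ≐ Q = carrierOf P ⊆ carrierOf Q × carrierOf Q ⊆ carrierOf P

  _∘𝔸_ : PrimeFilter → PrimeFilter → Pred PrimeFilter (c ⊔ ℓ)
  (F ∘𝔸 F') F'' = ∀ {a b} → a ∈ carrierOf F → b ∈ carrierOf F' → (a * b) ∈ carrierOf F''

  E𝔸 : Pred PrimeFilter (c ⊔ ℓ)
  E𝔸 F = ⊤* ∈ carrierOf F

  _▷𝔸_ : PrimeFilter → PrimeFilter → Pred PrimeFilter (c ⊔ ℓ)
  (F ▷𝔸 F') F'' = ∀ {a b} → a ∈ carrierOf F → b ∈ carrierOf F' → (a ︔ b) ∈ carrierOf F''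

  -- Boolean prime ideal theorem for 𝔸 (a ZFC theorem; assumed as a hypothesis)
  PrimeFilterTheorem : Set (suc (c ⊔ ℓ))
  PrimeFilterTheorem = ∀ (F I : Sub) → IsFilter F → IsIdeal I →
    (∀ a → a ∈ F → a ∉ I) →
    Σ Sub λ P → IsPrimeFilter P × F ⊆ P × (∀ a → a ∈ P → a ∉ I)

module Complex {ℓ} (𝒳 : CKBIFrame ℓ) where
  open CKBIFrame 𝒳

  Sub : Set (suc ℓ)
  Sub = Pred X ℓ

  _≐_ : Rel Sub ℓ
  A ≐ B = A ⊆ B × B ⊆ A

  _∩_ _∪_ _⇒_ : Op₂ Sub
  (A ∩ B) x = A x × B x
  (A ∪ B) x = A x ⊎ B x
  (A ⇒ B) x = (¬ A x) ⊎ B x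

  U ∅ : Sub
  U _ = ⊤
  ∅ _ = P⊥.⊥

  _•_ _-•_ : Op₂ Sub
  (A • B) x = Σ X λ y → Σ X λ z → A y × B z × x ∈ (y ∘ z)
  (A -• B) x = ∀ y z → z ∈ (x ∘ y) → A y → B z

  _︔X_ _⇀X_ _↼X_ : Op₂ Sub
  (A ︔X B) z = Σ X λ x → Σ X λ y → A x × B y × z ∈ (x ▷ y)
  (A ⇀X B) x = ∀ y z → z ∈ (x ▷ y) → A y → B z
  (A ↼X B) x = ∀ y z → z ∈ (y ▷ x) → A y → B z

-- Both halves are the usual Jónsson–Tarski duality for Boolean algebras with operators.
-- (1) Every residuated operation ⊙ of the algebra is monotone, normal and additive in each
-- argument, which is exactly what the prime extension lemma needs: if X ⊙ F ⊆ W
-- with X, F filters and W prime, then F extends to a prime P with X ⊙ P ⊆ W (apply the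
-- prime filter theorem to F and the ideal of those d sent out of W by some a ∈ X).
-- Each existential frame axiom is such an extension, applied to a filter generated by
-- products; the equational axioms of 𝔸 show that the hypothesis X ⊙ F ⊆ W holds.
-- (2) The operations of Com(𝒳) are images and residuals of ternary relations; the algebra
-- laws translate pointwise into the frame axioms, and excluded middle gives complements.
module Submission where

open import Defs
open import Level using (Level; _⊔_; Lift; lift)
open import Data.Product using (Σ; _×_; _,_; proj₁; proj₂; swap)
open import Data.Sum using (_⊎_; inj₁; inj₂; [_,_]) renaming (swap to ⊎-swap)
open import Data.Empty using (⊥-elim)
open import Function using (flip; _∘′_)
open import Relation.Nullary using (yes; no)
open import Relation.Unary using (Pred; _∈_; _∉_; _⊆_)
open import Relation.Unary.Algebra using (∪-∩-isDistributiveLattice)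
open import Relation.Unary.Relation.Binary.Equality using (≐-isEquivalence)
open import Relation.Binary.Core using (Rel)
open import Relation.Binary.PropositionalEquality as ≡ using (_≡_; subst)
open import Axiom.ExcludedMiddle using (ExcludedMiddle)
open import Axiom.DoubleNegationElimination using (em⇒dne)
open import Algebra.Core using (Op₂)
open import Algebra.Lattice.Bundles using (BooleanAlgebra)
import Algebra.Lattice.Properties.BooleanAlgebra as BooleanAlgebraProperties
import Algebra.Lattice.Properties.Lattice as LatticeProperties
import Algebra.Lattice.Structures as LatticeStructures
import Algebra.Structures as Structures
import Relation.Binary.Lattice as OrderLattice

module BooleanOrder {c ℓ} (B : BooleanAlgebra c ℓ) where
  open BooleanAlgebra B
  open BooleanAlgebraProperties B using (∧-identityʳ; ∧-zeroˡ)

  -- the library's order is  x ≈ x ∧ y,  the symmetric form of  LatLeq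
  private
    module O = OrderLattice.Lattice (LatticeProperties.∨-∧-orderTheoreticLattice lattice)

  _≤_ : Rel Carrier ℓ
  _≤_ = LatLeq _≈_ _∧_

  ≤-reflexive : ∀ {a b} → a ≈ b → a ≤ b
  ≤-reflexive a≈b = sym (O.reflexive a≈b)

  ≤-refl : ∀ {a} → a ≤ a
  ≤-refl = ≤-reflexive refl

  ≤-trans : ∀ {a b d} → a ≤ b → b ≤ d → a ≤ d
  ≤-trans a≤b b≤d = sym (O.trans (sym a≤b) (sym b≤d))

  x∧y≤x : ∀ a b → (a ∧ b) ≤ a
  x∧y≤x a b = sym (O.x∧y≤x a b)

  x∧y≤y : ∀ a b → (a ∧ b) ≤ b
  x∧y≤y a b = sym (O.x∧y≤y a b)

  ∧-greatest : ∀ {a b d} → d ≤ a → d ≤ b → d ≤ (a ∧ b)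
  ∧-greatest d≤a d≤b = sym (O.∧-greatest (sym d≤a) (sym d≤b))

  x≤x∨y : ∀ a b → a ≤ (a ∨ b)
  x≤x∨y a b = sym (O.x≤x∨y a b)

  y≤x∨y : ∀ a b → b ≤ (a ∨ b)
  y≤x∨y a b = sym (O.y≤x∨y a b)

  ∨-least : ∀ {a b d} → a ≤ d → b ≤ d → (a ∨ b) ≤ d
  ∨-least a≤d b≤d = sym (O.∨-least (sym a≤d) (sym b≤d))

  x≤⊤ : ∀ a → a ≤ ⊤
  x≤⊤ = ∧-identityʳ

  ⊥≤x : ∀ a → ⊥ ≤ a
  ⊥≤x = ∧-zeroˡ

  ⊤≤x∨¬x : ∀ a → ⊤ ≤ (a ∨ ¬ a)
  ⊤≤x∨¬x a = ≤-reflexive (sym (∨-complementʳ a))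

  x∧¬x≤⊥ : ∀ a → (a ∧ ¬ a) ≤ ⊥
  x∧¬x≤⊥ a = ≤-reflexive (∧-complementʳ a)

  record IsResidual (_⊙_ _⇨_ : Op₂ Carrier) : Set (c ⊔ ℓ) where
    field
      curry   : ∀ {a b d} → (a ⊙ b) ≤ d → a ≤ (b ⇨ d)
      uncurry : ∀ {a b d} → a ≤ (b ⇨ d) → (a ⊙ b) ≤ d

    monoˡ : ∀ {a a' b} → a ≤ a' → (a ⊙ b) ≤ (a' ⊙ b)
    monoˡ a≤a' = uncurry (≤-trans a≤a' (curry ≤-refl))

    distribˡ : ∀ a a' b → ((a ∨ a') ⊙ b) ≤ ((a ⊙ b) ∨ (a' ⊙ b))
    distribˡ a a' b = uncurry (∨-least (curry (x≤x∨y _ _)) (curry (y≤x∨y _ _)))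

    zeroˡ : ∀ b → (⊥ ⊙ b) ≤ ⊥
    zeroˡ b = uncurry (⊥≤x _)

  -- a Jónsson–Tarski operator; the reverse additivity inequalities follow from monotonicity
  record IsOperator (_⊙_ : Op₂ Carrier) : Set (c ⊔ ℓ) where
    field
      monoˡ    : ∀ {a a' b} → a ≤ a' → (a ⊙ b) ≤ (a' ⊙ b)
      monoʳ    : ∀ {a b b'} → b ≤ b' → (a ⊙ b) ≤ (a ⊙ b')
      distribˡ : ∀ a a' b → ((a ∨ a') ⊙ b) ≤ ((a ⊙ b) ∨ (a' ⊙ b))
      distribʳ : ∀ a b b' → (a ⊙ (b ∨ b')) ≤ ((a ⊙ b) ∨ (a ⊙ b'))
      zeroˡ    : ∀ b → (⊥ ⊙ b) ≤ ⊥
      zeroʳ    : ∀ a → (a ⊙ ⊥) ≤ ⊥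

    mono : ∀ {a a' b b'} → a ≤ a' → b ≤ b' → (a ⊙ b) ≤ (a' ⊙ b')
    mono a≤a' b≤b' = ≤-trans (monoˡ a≤a') (monoʳ b≤b')

  flip-isOperator : ∀ {_⊙_} → IsOperator _⊙_ → IsOperator (flip _⊙_)
  flip-isOperator op = record
    { monoˡ = monoʳ ; monoʳ = monoˡ
    ; distribˡ = λ a a' b → distribʳ b a a' ; distribʳ = λ a b b' → distribˡ b b' a
    ; zeroˡ = zeroʳ ; zeroʳ = zeroˡ }
    where open IsOperator op

  residuals⇒isOperator : ∀ {_⊙_ _⇨ˡ_ _⇨ʳ_} →
    IsResidual _⊙_ _⇨ˡ_ → IsResidual (flip _⊙_) _⇨ʳ_ → IsOperator _⊙_
  residuals⇒isOperator resˡ resʳ = record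
    { monoˡ = L.monoˡ ; monoʳ = R.monoˡ
    ; distribˡ = L.distribˡ ; distribʳ = λ a b b' → R.distribˡ b b' a
    ; zeroˡ = L.zeroˡ ; zeroʳ = R.zeroˡ }
    where module L = IsResidual resˡ
          module R = IsResidual resʳ

module FilterProperties {c ℓ} (𝔸 : CKBIAlgebra c ℓ) where
  open CKBIAlgebra 𝔸 hiding (_≤_)
  open IsCKBIAlgebra isCKBIAlgebra using (isBBIAlgebra)
  open IsBBIAlgebra isBBIAlgebra using (isBooleanAlgebra)
  open PrimeFilters 𝔸
  open IsFilter
  open IsPrimeFilter

  booleanAlgebra : BooleanAlgebra c ℓ
  booleanAlgebra = record { isBooleanAlgebra = isBooleanAlgebra }

  open BooleanAlgebra booleanAlgebra public using () renaming (sym to ≈-sym)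
  open BooleanOrder booleanAlgebra public

  _⟨_⟩_⊆_ : Sub → Op₂ Carrier → Sub → Sub → Set (c ⊔ ℓ)
  X ⟨ _⊙_ ⟩ Y ⊆ W = ∀ {a b} → a ∈ X → b ∈ Y → (a ⊙ b) ∈ W

  filter : (P : PrimeFilter) → IsFilter (carrierOf P)
  filter (_ , isPrime) = isFilter isPrime

  ∈-up : (P : PrimeFilter) → ∀ {a b} → a ∈ carrierOf P → a ≤ b → b ∈ carrierOf P
  ∈-up P = up (filter P)

  ↑ : Carrier → Sub
  ↑ a d = Lift (c ⊔ ℓ) (a ≤ d)

  ↑-isFilter : ∀ a → IsFilter (↑ a)
  ↑-isFilter a = record
    { top∈ = lift (x≤⊤ a)
    ; up = λ (lift a≤b) b≤d → lift (≤-trans a≤b b≤d)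
    ; ∧-closed = λ (lift a≤b) (lift a≤d) → lift (∧-greatest a≤b a≤d) }

  productFilter : Op₂ Carrier → Sub → Sub → Sub
  productFilter _⊙_ Y Z d = Σ Carrier λ b → Σ Carrier λ e → b ∈ Y × e ∈ Z × (b ⊙ e) ≤ d

  productFilter-isFilter : ∀ {_⊙_ Y Z} → IsOperator _⊙_ → IsFilter Y → IsFilter Z →
                           IsFilter (productFilter _⊙_ Y Z)
  productFilter-isFilter op Y Z = record
    { top∈ = ⊤ₐ , ⊤ₐ , top∈ Y , top∈ Z , x≤⊤ _
    ; up = λ (b , e , b∈Y , e∈Z , be≤d) d≤d' → b , e , b∈Y , e∈Z , ≤-trans be≤d d≤d'
    ; ∧-closed = λ (b , e , b∈Y , e∈Z , be≤d) (b' , e' , b'∈Y , e'∈Z , b'e'≤d') →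
        (b ∧ b') , (e ∧ e') , ∧-closed Y b∈Y b'∈Y , ∧-closed Z e∈Z e'∈Z ,
        ∧-greatest (≤-trans (mono (x∧y≤x b b') (x∧y≤x e e')) be≤d)
                   (≤-trans (mono (x∧y≤y b b') (x∧y≤y e e')) b'e'≤d') }
    where open IsOperator op

  productFilter-⊇ : ∀ {_⊙_ Y Z} → Y ⟨ _⊙_ ⟩ Z ⊆ productFilter _⊙_ Y Z
  productFilter-⊇ b∈Y e∈Z = _ , _ , b∈Y , e∈Z , ≤-refl

  prime-∈⊎¬∈ : ∀ {P} → IsPrimeFilter P → ∀ a → a ∈ P ⊎ (a ⇒ ⊥ₐ) ∈ P
  prime-∈⊎¬∈ P a = prime P (up (isFilter P) (top∈ (isFilter P)) (⊤≤x∨¬x a))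

  prime-⊆⇒≐ : ∀ {P Q} → carrierOf P ⊆ carrierOf Q → P ≐ Q
  prime-⊆⇒≐ {P , isP} {Q , isQ} P⊆Q = P⊆Q , Q⊆P
    where
      Q⊆P : Q ⊆ P
      Q⊆P {a} a∈Q with prime-∈⊎¬∈ isP a
      ... | inj₁ a∈P = a∈P
      ... | inj₂ ¬a∈P = ⊥-elim (proper isQ
              (up (isFilter isQ) (∧-closed (isFilter isQ) a∈Q (P⊆Q ¬a∈P)) (x∧¬x≤⊥ a)))

  unitʳ-≐ : ∀ {_⊙_} (Y U X : PrimeFilter) → (∀ a → (a ⊙ ⊤*) ≈ a) →
            carrierOf Y ⟨ _⊙_ ⟩ carrierOf U ⊆ carrierOf X → ⊤* ∈ carrierOf U → Y ≐ X
  unitʳ-≐ Y U X identityʳ YU⊆X ⊤*∈U =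
    prime-⊆⇒≐ {Y} {X} (λ a∈Y → ∈-up X (YU⊆X a∈Y ⊤*∈U) (≤-reflexive (identityʳ _)))

module PrimeExtension {c ℓ} (𝔸 : CKBIAlgebra c ℓ) (lem : ExcludedMiddle (c ⊔ ℓ))
                      (primeFilterTheorem : PrimeFilters.PrimeFilterTheorem 𝔸) where
  open CKBIAlgebra 𝔸 hiding (_≤_)
  open PrimeFilters 𝔸
  open FilterProperties 𝔸
  open IsFilter
  open IsPrimeFilter

  primeExtension : ∀ {_⊙_ X F W} → IsOperator _⊙_ → IsFilter X → IsFilter F → IsPrimeFilter W →
                   X ⟨ _⊙_ ⟩ F ⊆ W → Σ PrimeFilter λ P → F ⊆ carrierOf P × X ⟨ _⊙_ ⟩ carrierOf P ⊆ W
  primeExtension {_⊙_} {X} {F} {W} op X-filter F-filter W-prime XF⊆W =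
    let (P , P-prime , F⊆P , P-avoids) = primeFilterTheorem F Escaping F-filter Escaping-isIdeal
                                           (λ d d∈F (a , a∈X , ad∉W) → ad∉W (XF⊆W a∈X d∈F))
    in (P , P-prime) , F⊆P ,
       λ {a} {d} a∈X d∈P → em⇒dne lem (λ ad∉W → P-avoids d d∈P (a , a∈X , ad∉W))
    where
      open IsOperator op
      W-up : ∀ {a b} → a ∈ W → a ≤ b → b ∈ W
      W-up = up (isFilter W-prime)

      Escaping : Sub
      Escaping d = Σ Carrier λ a → a ∈ X × (a ⊙ d) ∉ W

      Escaping-isIdeal : IsIdeal Escaping
      Escaping-isIdeal = record
        { bot∈ = ⊤ₐ , top∈ X-filter , (λ ⊤⊥∈W → proper W-prime (W-up ⊤⊥∈W (zeroʳ ⊤ₐ)))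
        ; down = λ (a , a∈X , ad∉W) d'≤d → a , a∈X , (λ ad'∈W → ad∉W (W-up ad'∈W (monoʳ d'≤d)))
        ; ∨-closed = λ {d} {d'} (a , a∈X , ad∉W) (a' , a'∈X , a'd'∉W) →
            (a ∧ a') , ∧-closed X-filter a∈X a'∈X ,
            λ aa'dd'∈W → [ (λ ∈W → ad∉W (W-up ∈W (monoˡ (x∧y≤x a a'))))
                         , (λ ∈W → a'd'∉W (W-up ∈W (monoˡ (x∧y≤y a a')))) ]
                         (prime W-prime (W-up aa'dd'∈W (distribʳ (a ∧ a') d d'))) }

  unitExtension : ∀ {_⊙_} → IsOperator _⊙_ → (∀ a → (a ⊙ ⊤*) ≈ a) → (F : PrimeFilter) →
    Σ PrimeFilter λ P → ⊤* ∈ carrierOf P × carrierOf F ⟨ _⊙_ ⟩ carrierOf P ⊆ carrierOf F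
  unitExtension {_⊙_} op identityʳ (F , F-prime) =
    let (P , ↑⊤*⊆P , FP⊆F) = primeExtension op (isFilter F-prime) (↑-isFilter ⊤*) F-prime F↑⊤*⊆F
    in P , ↑⊤*⊆P (lift ≤-refl) , FP⊆F
    where
      F↑⊤*⊆F : F ⟨ _⊙_ ⟩ ↑ ⊤* ⊆ F
      F↑⊤*⊆F a∈F (lift ⊤*≤d) =
        up (isFilter F-prime) a∈F (≤-trans (≤-reflexive (≈-sym (identityʳ _))) (IsOperator.monoʳ op ⊤*≤d))

  productExtension : ∀ {_⊙_ _⊗_ X Y Z W} → IsOperator _⊙_ → IsOperator _⊗_ →
    IsFilter X → IsFilter Y → IsFilter Z → IsPrimeFilter W →
    (∀ {a b e} → a ∈ X → b ∈ Y → e ∈ Z → (a ⊙ (b ⊗ e)) ∈ W) →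
    Σ PrimeFilter λ P → Y ⟨ _⊗_ ⟩ Z ⊆ carrierOf P × X ⟨ _⊙_ ⟩ carrierOf P ⊆ W
  productExtension {_⊙_} {_⊗_} {X} {Y} {Z} {W} ⊙-op ⊗-op X-filter Y-filter Z-filter W-prime XYZ⊆W =
    let (P , [YZ]⊆P , XP⊆W) = primeExtension ⊙-op X-filter
                                (productFilter-isFilter ⊗-op Y-filter Z-filter) W-prime X[YZ]⊆W
    in P , (λ b∈Y e∈Z → [YZ]⊆P (productFilter-⊇ b∈Y e∈Z)) , XP⊆W
    where
      X[YZ]⊆W : X ⟨ _⊙_ ⟩ productFilter _⊗_ Y Z ⊆ W
      X[YZ]⊆W a∈X (b , e , b∈Y , e∈Z , be≤d) =
        up (isFilter W-prime) (XYZ⊆W a∈X b∈Y e∈Z) (IsOperator.monoʳ ⊙-op be≤d)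

module PrimeFilterFrame {c ℓ} (𝔸 : CKBIAlgebra c ℓ) (lem : ExcludedMiddle (c ⊔ ℓ))
                        (primeFilterTheorem : PrimeFilters.PrimeFilterTheorem 𝔸) where
  open CKBIAlgebra 𝔸 hiding (_≤_)
  open IsCKBIAlgebra isCKBIAlgebra hiding (_≤_; exchange)
  open IsBBIAlgebra isBBIAlgebra hiding (_≤_)
  open Structures.IsCommutativeMonoid *-isCommutativeMonoid using ()
    renaming (comm to *-comm; assoc to *-assoc; identityʳ to *-identityʳ)
  open Structures.IsMonoid ︔-isMonoid using ()
    renaming (assoc to ︔-assoc; identityˡ to ︔-identityˡ; identityʳ to ︔-identityʳ)
  open PrimeFilters 𝔸
  open FilterProperties 𝔸
  open PrimeExtension 𝔸 lem primeFilterTheorem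
  open IsBBIFrame
  open IsCKBIFrame

  private
    isPrime : (P : PrimeFilter) → IsPrimeFilter (carrierOf P)
    isPrime = proj₂

  *-isOperator : IsOperator _*_
  *-isOperator = residuals⇒isOperator
    (record { curry = residuation₁ _ _ _ ; uncurry = residuation₂ _ _ _ })
    (record { curry = λ ba≤d → residuation₁ _ _ _ (≤-trans (≤-reflexive (*-comm _ _)) ba≤d)
            ; uncurry = λ a≤b-*d → ≤-trans (≤-reflexive (*-comm _ _)) (residuation₂ _ _ _ a≤b-*d) })

  ︔-isOperator : IsOperator _︔_
  ︔-isOperator = residuals⇒isOperator
    (record { curry = ⇀-residual₁ _ _ _ ; uncurry = ⇀-residual₂ _ _ _ })
    (record { curry = ↼-residual₁ _ _ _ ; uncurry = ↼-residual₂ _ _ _ })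

  ∘-isBBIFrame : IsBBIFrame _≐_ _∘𝔸_ E𝔸
  ∘-isBBIFrame .comm {z = z} xy⊆z b∈y a∈x = ∈-up z (xy⊆z a∈x b∈y) (≤-reflexive (*-comm _ _))
  ∘-isBBIFrame .unit-ex = unitExtension *-isOperator *-identityʳ
  ∘-isBBIFrame .unit-eq {x} {y} {u} yu⊆x ⊤*∈u = unitʳ-≐ y u x *-identityʳ yu⊆x ⊤*∈u
  ∘-isBBIFrame .assoc {x = x} {y} {w} {z} xy⊆t tz⊆w =
    productExtension *-isOperator *-isOperator (filter x) (filter y) (filter z) (isPrime w)
      (λ a∈x b∈y e∈z → ∈-up w (tz⊆w (xy⊆t a∈x b∈y) e∈z) (≤-reflexive (*-assoc _ _ _)))

  isCKBIFrame : IsCKBIFrame _≐_ _∘𝔸_ E𝔸 _▷𝔸_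
  isCKBIFrame .isBBIFrame = ∘-isBBIFrame
  isCKBIFrame .▷-unitˡ-ex x =
    let (u , ⊤*∈u , xu⊆x) = unitExtension (flip-isOperator ︔-isOperator) ︔-identityˡ x
    in u , ⊤*∈u , λ e∈u a∈x → xu⊆x a∈x e∈u
  isCKBIFrame .▷-unitʳ-ex = unitExtension ︔-isOperator ︔-identityʳ
  isCKBIFrame .▷-unitˡ-eq {u} {x} {y} ⊤*∈u uy⊆x =
    swap (unitʳ-≐ y u x ︔-identityˡ (λ b∈y e∈u → uy⊆x e∈u b∈y) ⊤*∈u)
  isCKBIFrame .▷-unitʳ-eq {u} {x} {y} ⊤*∈u yu⊆x = swap (unitʳ-≐ y u x ︔-identityʳ yu⊆x ⊤*∈u)
  isCKBIFrame .▷-assoc₁ {x} {y} {z} {w} (t , xy⊆t , tz⊆w) =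
    productExtension ︔-isOperator ︔-isOperator (filter x) (filter y) (filter z) (isPrime w)
      (λ a∈x b∈y e∈z → ∈-up w (tz⊆w (xy⊆t a∈x b∈y) e∈z) (≤-reflexive (︔-assoc _ _ _)))
  isCKBIFrame .▷-assoc₂ {x} {y} {z} {w} (t' , yz⊆t' , xt'⊆w) =
    let (t , xy⊆t , zt⊆w) =
          productExtension (flip-isOperator ︔-isOperator) ︔-isOperator
            (filter z) (filter x) (filter y) (isPrime w)
            (λ e∈z a∈x b∈y → ∈-up w (xt'⊆w a∈x (yz⊆t' b∈y e∈z)) (≤-reflexive (≈-sym (︔-assoc _ _ _))))
    in t , xy⊆t , λ d∈t e∈z → zt⊆w e∈z d∈t
  isCKBIFrame .exchange {t} {w} {y} {s} {x} {z} {u} wy⊆t xz⊆s ts⊆u =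
    let (r , wx⊆r , [yz]r⊆u) =
          productExtension (flip-isOperator *-isOperator) ︔-isOperator
            (productFilter-isFilter ︔-isOperator (filter y) (filter z)) (filter w) (filter x)
            (isPrime u) [wx][yz]⊆u
        (v , yz⊆v , rv⊆u) =
          productExtension *-isOperator ︔-isOperator (filter r) (filter y) (filter z) (isPrime u)
            (λ a∈r d∈y g∈z → [yz]r⊆u (productFilter-⊇ d∈y g∈z) a∈r)
    in r , v , wx⊆r , yz⊆v , rv⊆u
    where
      [wx][yz]⊆u : ∀ {p a b} → p ∈ productFilter _︔_ (carrierOf y) (carrierOf z) →
                   a ∈ carrierOf w → b ∈ carrierOf x → ((a ︔ b) * p) ∈ carrierOf u
      [wx][yz]⊆u {a = a} {b} (d , g , d∈y , g∈z , dg≤p) a∈w b∈x =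
        ∈-up u (ts⊆u (wy⊆t a∈w d∈y) (xz⊆s b∈x g∈z))
          (≤-trans (IsCKBIAlgebra.exchange isCKBIAlgebra a d b g) (IsOperator.monoʳ *-isOperator dg≤p))

module PredicateOrder {x} {X : Set x} where
  open import Relation.Unary using (_≐_; _∩_)

  _≤_ : Rel (Pred X x) x
  _≤_ = LatLeq _≐_ _∩_

  ⊆⇒≤ : ∀ {A B} → A ⊆ B → A ≤ B
  ⊆⇒≤ A⊆B = proj₁ , λ a → a , A⊆B a

  ≤⇒⊆ : ∀ {A B} → A ≤ B → A ⊆ B
  ≤⇒⊆ (_ , A⊆A∩B) a = proj₂ (A⊆A∩B a)

module BBIFrameProperties {x e r r'} {X : Set x} {_≈_ : Rel X e} {_∘_ : X → X → Pred X r}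
                          {E : Pred X r'} (isBBIFrame : IsBBIFrame _≈_ _∘_ E) where
  open IsBBIFrame isBBIFrame

  ∘-assoc₁ : ∀ {a b e w} → (Σ X λ t → t ∈ (a ∘ b) × w ∈ (t ∘ e)) → Σ X λ s → s ∈ (b ∘ e) × w ∈ (a ∘ s)
  ∘-assoc₁ (t , t∈ab , w∈te) = assoc t∈ab w∈te

  ∘-assoc₂ : ∀ {a b e w} → (Σ X λ s → s ∈ (b ∘ e) × w ∈ (a ∘ s)) → Σ X λ t → t ∈ (a ∘ b) × w ∈ (t ∘ e)
  ∘-assoc₂ (s , s∈be , w∈as) =
    let (t , t∈ba , w∈et) = assoc (comm s∈be) (comm w∈as) in t , comm t∈ba , comm w∈et

-- Com(𝒳)'s • and -• are _⊗_ and _⊸_ for T = ∘; its ; ⇀ ↼ are _⊗_ _⊸_ _⟜_ for T = ▷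
module RelationalImage {x} {X : Set x} (T : X → X → Pred X x) where
  open import Relation.Unary using (_≐_)
  open PredicateOrder

  _⊗_ _⊸_ _⟜_ : Op₂ (Pred X x)
  (A ⊗ B) z = Σ X λ a → Σ X λ b → A a × B b × z ∈ T a b
  (A ⊸ B) a = ∀ b z → z ∈ T a b → A b → B z
  (A ⟜ B) b = ∀ a z → z ∈ T a b → A a → B z

  ⊗-cong : ∀ {A A' B B'} → A ≐ A' → B ≐ B' → (A ⊗ B) ≐ (A' ⊗ B')
  ⊗-cong (A⊆A' , A'⊆A) (B⊆B' , B'⊆B) =
    (λ (a , b , a∈A , b∈B , z∈ab) → a , b , A⊆A' a∈A , B⊆B' b∈B , z∈ab) ,
    (λ (a , b , a∈A , b∈B , z∈ab) → a , b , A'⊆A a∈A , B'⊆B b∈B , z∈ab)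

  ⊗-comm : (∀ {a b z} → z ∈ T a b → z ∈ T b a) → ∀ A B → (A ⊗ B) ≐ (B ⊗ A)
  ⊗-comm T-comm A B =
    (λ (a , b , a∈A , b∈B , z∈ab) → b , a , b∈B , a∈A , T-comm z∈ab) ,
    (λ (b , a , b∈B , a∈A , z∈ba) → a , b , a∈A , b∈B , T-comm z∈ba)

  ⊗-assoc : (∀ {a b e w} → (Σ X λ t → t ∈ T a b × w ∈ T t e) → Σ X λ s → s ∈ T b e × w ∈ T a s) →
            (∀ {a b e w} → (Σ X λ s → s ∈ T b e × w ∈ T a s) → Σ X λ t → t ∈ T a b × w ∈ T t e) →
            ∀ A B C → ((A ⊗ B) ⊗ C) ≐ (A ⊗ (B ⊗ C))
  ⊗-assoc T-assoc₁ T-assoc₂ A B C =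
    (λ (t , e , (a , b , a∈A , b∈B , t∈ab) , e∈C , w∈te) →
       let (s , s∈be , w∈as) = T-assoc₁ (t , t∈ab , w∈te)
       in a , s , a∈A , (b , e , b∈B , e∈C , s∈be) , w∈as) ,
    (λ (a , s , a∈A , (b , e , b∈B , e∈C , s∈be) , w∈as) →
       let (t , t∈ab , w∈te) = T-assoc₂ (s , s∈be , w∈as)
       in t , e , (a , b , a∈A , b∈B , t∈ab) , e∈C , w∈te)

  ⊗-identityʳ : ∀ {E} → (∀ a → Σ X λ u → u ∈ E × a ∈ T a u) →
                (∀ {a b u} → u ∈ E → a ∈ T b u → b ≡ a) → ∀ A → (A ⊗ E) ≐ A
  ⊗-identityʳ unit-ex unit-eq A =
    (λ (b , u , b∈A , u∈E , a∈bu) → subst A (unit-eq u∈E a∈bu) b∈A) ,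
    (λ {a} a∈A → let (u , u∈E , a∈au) = unit-ex a in a , u , a∈A , u∈E , a∈au)

  ⊗-identityˡ : ∀ {E} → (∀ a → Σ X λ u → u ∈ E × a ∈ T u a) →
                (∀ {a b u} → u ∈ E → a ∈ T u b → b ≡ a) → ∀ A → (E ⊗ A) ≐ A
  ⊗-identityˡ unit-ex unit-eq A =
    (λ (u , b , u∈E , b∈A , a∈ub) → subst A (unit-eq u∈E a∈ub) b∈A) ,
    (λ {a} a∈A → let (u , u∈E , a∈ua) = unit-ex a in u , a , u∈E , a∈A , a∈ua)

  ⊗-⊸-residual₁ : ∀ A B D → (A ⊗ B) ≤ D → A ≤ (B ⊸ D)
  ⊗-⊸-residual₁ A B D AB≤D = ⊆⇒≤ λ a∈A b z z∈ab b∈B → ≤⇒⊆ AB≤D (_ , b , a∈A , b∈B , z∈ab)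

  ⊗-⊸-residual₂ : ∀ A B D → A ≤ (B ⊸ D) → (A ⊗ B) ≤ D
  ⊗-⊸-residual₂ A B D A≤B⊸D = ⊆⇒≤ λ (a , b , a∈A , b∈B , z∈ab) → ≤⇒⊆ A≤B⊸D a∈A b _ z∈ab b∈B

  ⊗-⟜-residual₁ : ∀ A B D → (A ⊗ B) ≤ D → B ≤ (A ⟜ D)
  ⊗-⟜-residual₁ A B D AB≤D = ⊆⇒≤ λ b∈B a z z∈ab a∈A → ≤⇒⊆ AB≤D (a , _ , a∈A , b∈B , z∈ab)

  ⊗-⟜-residual₂ : ∀ A B D → B ≤ (A ⟜ D) → (A ⊗ B) ≤ D
  ⊗-⟜-residual₂ A B D B≤A⟜D = ⊆⇒≤ λ (a , b , a∈A , b∈B , z∈ab) → ≤⇒⊆ B≤A⟜D b∈B a _ z∈ab a∈A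

module ComplexAlgebra {ℓx} (𝒳 : CKBIFrame ℓx) (lem : ExcludedMiddle ℓx) where
  open CKBIFrame 𝒳
  open Complex 𝒳
  open IsCKBIFrame isCKBIFrame
  open IsBBIFrame isBBIFrame
  open BBIFrameProperties isBBIFrame
  open PredicateOrder
  module • = RelationalImage _∘_
  module ︔ = RelationalImage _▷_

  ∁ : Sub → Sub
  ∁ A = A ⇒ ∅

  ∈⊎∈∁ : ∀ A a → a ∈ A ⊎ a ∈ ∁ A
  ∈⊎∈∁ A a with lem {A a}
  ... | yes a∈A = inj₁ a∈A
  ... | no a∉A = inj₂ (inj₁ a∉A)

  isBooleanAlgebra : LatticeStructures.IsBooleanAlgebra _≐_ _∪_ _∩_ ∁ U ∅
  isBooleanAlgebra = record
    { isDistributiveLattice = ∪-∩-isDistributiveLattice X ℓx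
    ; ∨-complement = (λ A → _ , λ {a} _ → ⊎-swap (∈⊎∈∁ A a)) , (λ A → _ , λ {a} _ → ∈⊎∈∁ A a)
    ; ∧-complement = (λ A → (λ { (inj₁ a∉A , a∈A) → ⊥-elim (a∉A a∈A) }) , λ ()) ,
                     (λ A → (λ { (a∈A , inj₁ a∉A) → ⊥-elim (a∉A a∈A) }) , λ ())
    ; ¬-cong = λ (A⊆B , B⊆A) → (λ { (inj₁ a∉A) → inj₁ (λ a∈B → a∉A (B⊆A a∈B)) })
                             , (λ { (inj₁ a∉B) → inj₁ (λ a∈A → a∉B (A⊆B a∈A)) })
    }

  •-identityʳ : ∀ A → (A • E) ≐ A
  •-identityʳ = •.⊗-identityʳ unit-ex (λ u∈E a∈bu → unit-eq a∈bu u∈E)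

  •-identityˡ : ∀ A → (E • A) ≐ A
  •-identityˡ = •.⊗-identityˡ (λ a → let (u , u∈E , a∈au) = unit-ex a in u , u∈E , comm a∈au)
                              (λ u∈E a∈ub → unit-eq (comm a∈ub) u∈E)

  ︔X-identityʳ : ∀ A → (A ︔X E) ≐ A
  ︔X-identityʳ = ︔.⊗-identityʳ ▷-unitʳ-ex (λ u∈E a∈bu → ≡.sym (▷-unitʳ-eq u∈E a∈bu))

  ︔X-identityˡ : ∀ A → (E ︔X A) ≐ A
  ︔X-identityˡ = ︔.⊗-identityˡ ▷-unitˡ-ex (λ u∈E a∈ub → ≡.sym (▷-unitˡ-eq u∈E a∈ub))

  •-︔X-exchange : ∀ A B C D → ((A • B) ︔X (C • D)) ≤ ((A ︔X C) • (B ︔X D))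
  •-︔X-exchange A B C D = ⊆⇒≤ λ (t , s , (w , y , a , b , t∈wy) , (x , z , c , d , s∈xz) , u∈ts) →
    let (r , v , r∈wx , v∈yz , u∈rv) = exchange t∈wy s∈xz u∈ts
    in r , v , (w , x , a , c , r∈wx) , (y , z , b , d , v∈yz) , u∈rv

  isCKBIAlgebra : IsCKBIAlgebra _≐_ _∩_ _∪_ _⇒_ U ∅ _•_ _-•_ E _︔X_ _⇀X_ _↼X_
  isCKBIAlgebra = record
    { isBBIAlgebra = record
      { isBooleanAlgebra = isBooleanAlgebra
      ; ⇒-def = λ A B → [ inj₁ ∘′ inj₁ , inj₂ ] , [ [ inj₁ , (λ ()) ] , inj₂ ]
      ; *-isCommutativeMonoid = record
        { isMonoid = record
          { isSemigroup = record
            { isMagma = record { isEquivalence = ≐-isEquivalence ; ∙-cong = •.⊗-cong }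
            ; assoc = •.⊗-assoc ∘-assoc₁ ∘-assoc₂ }
          ; identity = •-identityˡ , •-identityʳ }
        ; comm = •.⊗-comm comm }
      ; residuation₁ = •.⊗-⊸-residual₁
      ; residuation₂ = •.⊗-⊸-residual₂ }
    ; ︔-isMonoid = record
      { isSemigroup = record
        { isMagma = record { isEquivalence = ≐-isEquivalence ; ∙-cong = ︔.⊗-cong }
        ; assoc = ︔.⊗-assoc ▷-assoc₁ ▷-assoc₂ }
      ; identity = ︔X-identityˡ , ︔X-identityʳ }
    ; ⇀-residual₁ = ︔.⊗-⊸-residual₁
    ; ⇀-residual₂ = ︔.⊗-⊸-residual₂
    ; ↼-residual₁ = ︔.⊗-⟜-residual₁
    ; ↼-residual₂ = ︔.⊗-⟜-residual₂
    ; exchange = •-︔X-exchange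
    }

lemma6p29 : ∀ {c ℓ ℓx : Level} →
    ((𝔸 : CKBIAlgebra c ℓ) → ExcludedMiddle (c ⊔ ℓ) →
      PrimeFilters.PrimeFilterTheorem 𝔸 →
      IsCKBIFrame (PrimeFilters._≐_ 𝔸) (PrimeFilters._∘𝔸_ 𝔸)
        (PrimeFilters.E𝔸 𝔸) (PrimeFilters._▷𝔸_ 𝔸))
    ×
    ((𝒳 : CKBIFrame ℓx) → ExcludedMiddle ℓx →
      IsCKBIAlgebra (Complex._≐_ 𝒳) (Complex._∩_ 𝒳) (Complex._∪_ 𝒳)
        (Complex._⇒_ 𝒳) (Complex.U 𝒳) (Complex.∅ 𝒳) (Complex._•_ 𝒳)
        (Complex._-•_ 𝒳) (CKBIFrame.E 𝒳) (Complex._︔X_ 𝒳)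
        (Complex._⇀X_ 𝒳) (Complex._↼X_ 𝒳))
lemma6p29 = PrimeFilterFrame.isCKBIFrame , ComplexAlgebra.isCKBIAlgebra
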